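{- For any connected finite simple graph $G$ of order $n \ge 2$ and any integer $p \ge n$, $\gamma(M(G+\overline{K_p})) = p$.
   Context: $\overline{K_p}$ denotes the edgeless graph on $p$ vertices. The join $G+H$ of graphs with disjoint vertex sets has vertex set $V(G)\cup V(H)$ and edge set $E(G)\cup E(H)\cup\{vw : v\in V(G), w\in V(H)\}$. For a finite simple graph $H$, the middle graph $M(H)$ is the graph with vertex set $V(H)\cup E(H)$ in which two elements $x,y$ are adjacent if and only if either (1) $x,y\in E(H)$ and the edges $x,y$ share a common endpoint in $H$, or (2) $x\in V(H)$, $y\in E(H)$ and $x$ is an endpoint of $y$ (or vice versa). A dominating set of a graph $H$ is a set $S\subseteq V(H)$ such that every vertex of $H$ is in $S$ or adjacent to a vertex of $S$; the domination number $\gamma(H)$ is the minimum cardinality of a dominating set of $H$. -}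

module Defs where

open import Data.Nat using (ℕ; _+_; _≤_)
open import Data.Fin using (Fin; splitAt; _<_)
open import Data.Bool using (Bool; true; false; T)
open import Data.Sum using (_⊎_; inj₁; inj₂)
open import Data.Product using (Σ; ∃; _×_; _,_)
open import Data.Empty using (⊥)
open import Data.List using (List; length)
open import Data.List.Membership.Propositional using (_∈_)
open import Data.List.Relation.Unary.Unique.Propositional using (Unique)
open import Relation.Binary.PropositionalEquality using (_≡_; _≢_)

record Graph (n : ℕ) : Set where
  field
    adj    : Fin n → Fin n → Bool
    sym    : ∀ x y → adj x y ≡ adj y x
    irrefl : ∀ x → adj x x ≡ false
open Graph public

data Reach {n : ℕ} (G : Graph n) : Fin n → Fin n → Set where
  here : ∀ {x} → Reach G x x
  step : ∀ {x y z} → T (adj G x y) → Reach G y z → Reach G x z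

Connected : ∀ {n} → Graph n → Set
Connected G = ∀ x y → Reach G x y

edgeless : (p : ℕ) → Graph p
edgeless p = record { adj = λ _ _ → false ; sym = λ _ _ → _≡_.refl ; irrefl = λ _ → _≡_.refl }

-- The join G + H on Fin (n + m): first n vertices are those of G, last m those of H.
joinAdj : ∀ {n m} → Graph n → Graph m → Fin (n + m) → Fin (n + m) → Bool
joinAdj {n} G H x y with splitAt n x | splitAt n y
... | inj₁ a | inj₁ b = adj G a b
... | inj₂ a | inj₂ b = adj H a b
... | inj₁ _ | inj₂ _ = true
... | inj₂ _ | inj₁ _ = true

joinSym : ∀ {n m} (G : Graph n) (H : Graph m) x y → joinAdj G H x y ≡ joinAdj G H y x
joinSym {n} G H x y with splitAt n x | splitAt n y
... | inj₁ a | inj₁ b = sym G a b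
... | inj₂ a | inj₂ b = sym H a b
... | inj₁ _ | inj₂ _ = _≡_.refl
... | inj₂ _ | inj₁ _ = _≡_.refl

joinIrr : ∀ {n m} (G : Graph n) (H : Graph m) x → joinAdj G H x x ≡ false
joinIrr {n} G H x with splitAt n x
... | inj₁ a = irrefl G a
... | inj₂ a = irrefl H a

_⊕_ : ∀ {n m} → Graph n → Graph m → Graph (n + m)
G ⊕ H = record { adj = joinAdj G H ; sym = joinSym G H ; irrefl = joinIrr G H }

-- Edges of a graph on Fin n: pairs (i , j) with i < j and i adjacent to j
-- (each unordered edge is represented exactly once).
Edge : ∀ {n} → Graph n → Set
Edge {n} G = Σ (Fin n × Fin n) λ { (i , j) → i < j × T (adj G i j) }

Endpoint : ∀ {n} (G : Graph n) → Fin n → Edge G → Set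
Endpoint G x ((i , j) , _) = x ≡ i ⊎ x ≡ j

-- The middle graph M(G): vertex set V(G) ⊎ E(G), adjacency as in the paper.
MVertex : ∀ {n} → Graph n → Set
MVertex {n} G = Fin n ⊎ Edge G

MAdj : ∀ {n} (G : Graph n) → MVertex G → MVertex G → Set
MAdj G (inj₁ _) (inj₁ _) = ⊥
MAdj G (inj₁ v) (inj₂ e) = Endpoint G v e
MAdj G (inj₂ e) (inj₁ v) = Endpoint G v e
MAdj {n} G (inj₂ e) (inj₂ f) = e ≢ f × Σ (Fin n) λ v → Endpoint G v e × Endpoint G v f

-- Domination in a graph given by a vertex type and adjacency relation.
-- A dominating set is a duplicate-free list of vertices; its size is its length.
Dominating : {V : Set} → (V → V → Set) → List V → Set
Dominating {V} A S = Unique S × (∀ v → v ∈ S ⊎ Σ V λ w → w ∈ S × A w v)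

DominationNumber : {V : Set} → (V → V → Set) → ℕ → Set
DominationNumber A k =
  (Σ _ λ S → Dominating A S × length S ≡ k) × (∀ S → Dominating A S → k ≤ length S)

-- Lower bound (valid for every graph): if J has an independent set of p
-- vertices then every dominating set of M(J) has at least p elements.  Each
-- independent vertex x must be dominated by x itself or by an edge at x, and
-- no element of M(J) can serve two independent vertices this way, so choosing
-- a dominator for each gives an injection into the dominating set.  The p
-- vertices of K̄ₚ form such an independent set in G + K̄ₚ.
--
-- Upper bound: given a map c : Fin p → Fin n with a section, the p "spokes"
-- {c(k), vₖ} (vₖ the k-th vertex of K̄ₚ) dominate M(G + K̄ₚ): a vertex is an
-- endpoint of some spoke, an edge of G shares its left endpoint with a spoke,
-- and a cross edge {u, vₖ} either is the spoke at vₖ or meets it in vₖ.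
-- Such a c exists as soon as 1 ≤ n ≤ p.
module Submission where

open import Defs hiding (sym)
open import Data.Nat using (ℕ; suc; _+_; _≤_)
import Data.Nat as ℕ
import Data.Nat.Properties as ℕP
open import Data.Fin as Fin using (Fin; splitAt; _↑ˡ_; _↑ʳ_; toℕ; fromℕ<; inject≤; _<_; _≟_)
open import Data.Fin.Properties
  using ( splitAt-↑ˡ; splitAt-↑ʳ; splitAt⁻¹-↑ˡ; splitAt⁻¹-↑ʳ
        ; toℕ-↑ˡ; toℕ-↑ʳ; toℕ<n; ↑ˡ-injective; ↑ʳ-injective
        ; <-irrefl; <-asym; <-irrelevant; toℕ-injective; toℕ-fromℕ<; toℕ-inject≤
        ; injective⇒≤ )
open import Data.Bool using (true; false; T)
open import Data.Bool.Properties using (T-irrelevant)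
open import Data.Unit using (tt)
open import Data.Sum using (_⊎_; inj₁; inj₂)
open import Data.Product using (Σ; _×_; _,_; proj₁; proj₂)
open import Data.Empty using (⊥-elim)
open import Data.List using (List; length; tabulate; lookup)
open import Data.List.Properties using (length-tabulate)
open import Data.List.Membership.Propositional using (_∈_)
open import Data.List.Membership.Propositional.Properties using (∈-tabulate⁺)
open import Data.List.Relation.Unary.Any using (index)
open import Data.List.Relation.Unary.Any.Properties using (lookup-index)
open import Data.List.Relation.Unary.Unique.Propositional.Properties using (tabulate⁺)
open import Function.Definitions using (Injective)
open import Relation.Nullary using (yes; no)
open import Relation.Binary.PropositionalEquality

-- A list containing p distinct values has length at least p: the positions
-- at which they occur form an injection Fin p → Fin (length S).
injection-into-list : {V : Set} {p : ℕ} (f : Fin p → V) → Injective _≡_ _≡_ f →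
  (S : List V) → (∀ k → f k ∈ S) → p ≤ length S
injection-into-list f f-inj S f∈S = injective⇒≤ position-injective
  where
  position : ∀ k → Fin (length S)
  position k = index (f∈S k)

  position-injective : Injective _≡_ _≡_ position
  position-injective {a} {b} eq = f-inj (begin
    f a                   ≡⟨ lookup-index (f∈S a) ⟩
    lookup S (position a) ≡⟨ cong (lookup S) eq ⟩
    lookup S (position b) ≡⟨ lookup-index (f∈S b) ⟨
    f b                   ∎)
    where open ≡-Reasoning

dominator : {V : Set} {A : V → V → Set} {S : List V} → Dominating A S →
  (v : V) → Σ V λ w → w ∈ S × (w ≡ v ⊎ A w v)
dominator (_ , dominates) v with dominates v
... | inj₁ v∈S             = v , v∈S , inj₁ refl
... | inj₂ (w , w∈S , Awv) = w , w∈S , inj₂ Awv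

shared-dominator : ∀ {N} (J : Graph N) {x y : Fin N} (w : MVertex J) →
  w ≡ inj₁ x ⊎ MAdj J w (inj₁ x) → w ≡ inj₁ y ⊎ MAdj J w (inj₁ y) →
  x ≡ y ⊎ T (adj J x y)
shared-dominator J (inj₁ _) (inj₁ refl) (inj₁ refl) = inj₁ refl
shared-dominator J (inj₂ ((i , j) , _ , ij)) (inj₂ x-end) (inj₂ y-end) =
  both-endpoints x-end y-end
  where
  both-endpoints : ∀ {x y} → x ≡ i ⊎ x ≡ j → y ≡ i ⊎ y ≡ j → x ≡ y ⊎ T (adj J x y)
  both-endpoints (inj₁ refl) (inj₁ refl) = inj₁ refl
  both-endpoints (inj₂ refl) (inj₂ refl) = inj₁ refl
  both-endpoints (inj₁ refl) (inj₂ refl) = inj₂ ij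
  both-endpoints (inj₂ refl) (inj₁ refl) = inj₂ (subst T (Graph.sym J i j) ij)

independent⇒domination-≥ : ∀ {N p} (J : Graph N) (ι : Fin p → Fin N) →
  Injective _≡_ _≡_ ι → (∀ a b → adj J (ι a) (ι b) ≡ false) →
  ∀ S → Dominating (MAdj J) S → p ≤ length S
independent⇒domination-≥ J ι ι-injective independent S D =
  injection-into-list chosen chosen-injective S (λ a → proj₁ (proj₂ (choice a)))
  where
  Dominates : Fin _ → MVertex J → Set
  Dominates a w = w ≡ inj₁ (ι a) ⊎ MAdj J w (inj₁ (ι a))

  choice : ∀ a → Σ (MVertex J) λ w → w ∈ S × Dominates a w
  choice a = dominator D (inj₁ (ι a))

  chosen : Fin _ → MVertex J
  chosen a = proj₁ (choice a)

  chosen-injective : Injective _≡_ _≡_ chosen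
  chosen-injective {a} {b} eq
    with shared-dominator J (chosen b) (subst (Dominates a) eq (proj₂ (proj₂ (choice a))))
                                      (proj₂ (proj₂ (choice b)))
  ... | inj₁ ιa≡ιb = ι-injective ιa≡ιb
  ... | inj₂ ιa~ιb = ⊥-elim (subst T (independent a b) ιa~ιb)

data Side (n m : ℕ) : Fin (n + m) → Set where
  left  : (u : Fin n) → Side n m (u ↑ˡ m)
  right : (k : Fin m) → Side n m (n ↑ʳ k)

side : ∀ n {m} (x : Fin (n + m)) → Side n m x
side n {m} x with splitAt n x in eq
... | inj₁ u = subst (Side n m) (splitAt⁻¹-↑ˡ eq) (left u)
... | inj₂ k = subst (Side n m) (splitAt⁻¹-↑ʳ eq) (right k)

module _ {n m : ℕ} (G : Graph n) (H : Graph m) where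

  join-adj-cross : ∀ u k → joinAdj G H (u ↑ˡ m) (n ↑ʳ k) ≡ true
  join-adj-cross u k rewrite splitAt-↑ˡ n u m | splitAt-↑ʳ n m k = refl

  join-adj-right : ∀ a b → joinAdj G H (n ↑ʳ a) (n ↑ʳ b) ≡ adj H a b
  join-adj-right a b rewrite splitAt-↑ʳ n m a | splitAt-↑ʳ n m b = refl

left<right : ∀ {n m} (u : Fin n) (k : Fin m) → u ↑ˡ m < n ↑ʳ k
left<right {n} {m} u k rewrite toℕ-↑ˡ u m | toℕ-↑ʳ n k =
  ℕP.<-≤-trans (toℕ<n u) (ℕP.m≤m+n n (toℕ k))

left≢right : ∀ {n m} (u : Fin n) (k : Fin m) → u ↑ˡ m ≢ n ↑ʳ k
left≢right u k eq = <-irrefl eq (left<right u k)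

edge-≡ : ∀ {n} {G : Graph n} (e f : Edge G) → proj₁ e ≡ proj₁ f → e ≡ f
edge-≡ ((i , j) , i<j , ij) ((.i , .j) , i<j′ , ij′) refl
  rewrite <-irrelevant i<j i<j′ | T-irrelevant ij ij′ = refl

cross-edge : ∀ {n m} (G : Graph n) (H : Graph m) → Fin n → Fin m → Edge (G ⊕ H)
cross-edge G H u k =
  (u ↑ˡ _ , _ ↑ʳ k) , left<right u k , subst T (sym (join-adj-cross G H u k)) tt

module Spokes {n p : ℕ} (G : Graph n) (c : Fin p → Fin n)
              (cover : Fin n → Fin p) (c∘cover : ∀ u → c (cover u) ≡ u) where

  GK : Graph (n + p)
  GK = G ⊕ edgeless p

  spoke-edge : Fin p → Edge GK
  spoke-edge k = cross-edge G (edgeless p) (c k) k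

  spoke : Fin p → MVertex GK
  spoke k = inj₂ (spoke-edge k)

  spokes : List (MVertex GK)
  spokes = tabulate spoke

  spoke∈spokes : ∀ k → spoke k ∈ spokes
  spoke∈spokes = ∈-tabulate⁺

  spoke-injective : Injective _≡_ _≡_ spoke
  spoke-injective {a} {b} eq = ↑ʳ-injective n a b (cong far-end eq)
    where
    far-end : MVertex GK → Fin (n + p)
    far-end (inj₁ x) = x
    far-end (inj₂ ((_ , j) , _)) = j

  on-spoke : ∀ u → Endpoint GK (u ↑ˡ p) (spoke-edge (cover u))
  on-spoke u = inj₁ (cong (_↑ˡ p) (sym (c∘cover u)))

  Dominated : MVertex GK → Set
  Dominated v = v ∈ spokes ⊎ Σ (MVertex GK) λ w → w ∈ spokes × MAdj GK w v

  -- A cross edge {u, vₖ} is the spoke at vₖ, or meets it in vₖ.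
  cross-dominated : ∀ u k (u<k : u ↑ˡ p < n ↑ʳ k) (uk : T (adj GK (u ↑ˡ p) (n ↑ʳ k))) →
    Dominated (inj₂ ((u ↑ˡ p , n ↑ʳ k) , u<k , uk))
  cross-dominated u k u<k uk with c k ≟ u
  ... | yes refl =
    inj₁ (subst (_∈ spokes) (cong inj₂ (edge-≡ {G = GK} (spoke-edge k) _ refl)) (spoke∈spokes k))
  ... | no ck≢u =
    inj₂ (spoke k , spoke∈spokes k , distinct , n ↑ʳ k , inj₂ refl , inj₂ refl)
    where
    distinct : spoke-edge k ≢ ((u ↑ˡ p , n ↑ʳ k) , u<k , uk)
    distinct eq = ck≢u (↑ˡ-injective p (c k) u (cong (λ e → proj₁ (proj₁ e)) eq))

  -- Vertices lie on spokes; edges inside G meet the spoke at their left end;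
  -- K̄ₚ has no edges, and no edge goes from the K̄ₚ-side down to the G-side.
  dominated : ∀ v → Dominated v
  dominated (inj₁ x) with side n x
  ... | left u  = inj₂ (spoke (cover u) , spoke∈spokes _ , on-spoke u)
  ... | right k = inj₂ (spoke k , spoke∈spokes k , inj₂ refl)
  dominated (inj₂ ((i , j) , i<j , ij)) with side n i | side n j
  ... | left u  | left v  =
    inj₂ (spoke (cover u) , spoke∈spokes _ , distinct , u ↑ˡ p , on-spoke u , inj₁ refl)
    where
    -- the spoke ends in K̄ₚ, this edge does not
    distinct : spoke-edge (cover u) ≢ ((u ↑ˡ p , v ↑ˡ p) , i<j , ij)
    distinct eq = left≢right v (cover u) (sym (cong (λ e → proj₂ (proj₁ e)) eq))
  ... | left u  | right k = cross-dominated u k i<j ij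
  ... | right a | right b = ⊥-elim (subst T (join-adj-right G (edgeless p) a b) ij)
  ... | right a | left v  = ⊥-elim (<-asym i<j (left<right v a))

  spokes-dominate : Dominating (MAdj GK) spokes
  spokes-dominate = tabulate⁺ spoke-injective , dominated

-- For a nonempty Fin n with n ≤ p: a map Fin p → Fin n fixing the first n
-- elements, hence with section inject≤.
module Retraction {n p : ℕ} (default : Fin n) (n≤p : n ≤ p) where

  retract : Fin p → Fin n
  retract k with toℕ k ℕ.<? n
  ... | yes k<n = fromℕ< k<n
  ... | no _    = default

  retract-inject≤ : ∀ u → retract (inject≤ u n≤p) ≡ u
  retract-inject≤ u with toℕ (inject≤ u n≤p) ℕ.<? n
  ... | yes k<n = toℕ-injective (trans (toℕ-fromℕ< k<n) (toℕ-inject≤ u n≤p))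
  ... | no k≮n  = ⊥-elim (k≮n (subst (ℕ._< n) (sym (toℕ-inject≤ u n≤p)) (toℕ<n u)))

theorem2p15 : (n : ℕ) (G : Graph n) → Connected G → 2 ≤ n →
    (p : ℕ) → n ≤ p → DominationNumber (MAdj (G ⊕ edgeless p)) p
theorem2p15 n@(suc _) G _ _ p n≤p =
  (spokes , spokes-dominate , length-tabulate spoke) ,
  independent⇒domination-≥ GK (n ↑ʳ_) (↑ʳ-injective n _ _) (join-adj-right G (edgeless p))
  where
  open Retraction Fin.zero n≤p
  open Spokes G retract (λ u → inject≤ u n≤p) retract-inject≤
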